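{- Let $G$ be a digraph, $b\in V(G)$, and let $I\subseteq V(G)\setminus\{b\}$ be maximal with the property that every finite subset of $I$ has a linkage into $b$. Let $v\in (V(G)\setminus\{b\})\setminus I$. Then there is a set $D\subseteq V(G)$ that is exact for $I$ and $b$ and contains $v$.
   Context: Paths are finite directed paths; "disjoint" means edge-disjoint. A finite set $S$ has a linkage into $b$ if there are pairwise edge-disjoint directed paths from each $s\in S$ to $b$. For $D\subseteq V(G)$, an edge is $D$-crossing if its start vertex is in $D$ and its end vertex is not; the order of $D$ is the number of $D$-crossing edges. $D$ is exact (for $I$ and $b$) if $b\notin D$ and the order of $D$ is finite and equal to $|D\cap I|$. -}

module Defs where

open import Data.Nat using (ℕ)
open import Data.List using (List; []; _∷_; length; lookup)
open import Data.List.Membership.Propositional using (_∈_)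
open import Data.List.Relation.Unary.All using (All)
open import Data.List.Relation.Unary.Unique.Propositional using (Unique)
open import Data.Fin using (Fin)
open import Data.Product using (Σ; _×_; ∃; ∃-syntax)
open import Data.Empty using (⊥)
open import Relation.Nullary using (¬_)
open import Relation.Binary.PropositionalEquality using (_≡_; _≢_)

record Digraph : Set₁ where
  field
    V   : Set
    E   : Set
    src : E → V
    tgt : E → V

module _ (G : Digraph) where
  open Digraph G

  data Walk : V → V → Set where
    []  : ∀ {v} → Walk v v
    _∷_ : (e : E) → ∀ {w} → Walk (tgt e) w → Walk (src e) w

  vertices : ∀ {u w} → Walk u w → List V
  vertices {u} []       = u ∷ []
  vertices (e ∷ p)      = src e ∷ vertices p

  edges : ∀ {u w} → Walk u w → List E
  edges []      = []
  edges (e ∷ p) = e ∷ edges p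

  record Path (u w : V) : Set where
    constructor path
    field
      walk     : Walk u w
      distinct : Unique (vertices walk)
  open Path public

  EdgeDisjoint : ∀ {u u' w w'} → Path u w → Path u' w' → Set
  EdgeDisjoint p q = ∀ e → e ∈ edges (walk p) → e ∈ edges (walk q) → ⊥

  -- A finite set S of vertices, given as a duplicate-free list xs,
  -- has a linkage into b: pairwise edge-disjoint paths from each s ∈ S to b.
  HasLinkage : List V → V → Set
  HasLinkage xs b =
    Σ ((i : Fin (length xs)) → Path (lookup xs i) b) λ P →
      ∀ i j → i ≢ j → EdgeDisjoint (P i) (P j)

  FinitelyLinkable : (V → Set) → V → Set
  FinitelyLinkable I b =
    ∀ (xs : List V) → Unique xs → All I xs → HasLinkage xs b

  MaximalLinkable : (V → Set) → V → Set₁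
  MaximalLinkable I b =
    (∀ x → I x → x ≢ b)
    × FinitelyLinkable I b
    × (∀ (J : V → Set) → (∀ x → I x → J x) → (∀ x → J x → x ≢ b)
         → FinitelyLinkable J b → ∀ x → J x → I x)

HasSize : {A : Set} → (A → Set) → ℕ → Set
HasSize {A} P n =
  Σ (List A) λ xs → Unique xs × (∀ x → x ∈ xs → P x) × (∀ x → P x → x ∈ xs)
    × length xs ≡ n

module _ (G : Digraph) where
  open Digraph G

  Crossing : (V → Set) → E → Set
  Crossing D e = D (src e) × ¬ D (tgt e)

  HasOrder : (V → Set) → ℕ → Set
  HasOrder D n = HasSize (Crossing D) n

  Exact : (V → Set) → V → (V → Set) → Set
  Exact I b D = ¬ D b × ∃[ n ] (HasOrder D n × HasSize (λ x → D x × I x) n)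

module Submission where

-- Since I is maximal and v ∉ I, some finite X ⊆ I ∪ {v} has no linkage into b; X contains v,
-- and F = X ∖ {v} ⊆ I has a linkage P. Let D be the set of vertices reachable from v in the
-- residual graph of P (edges off P used forwards, edges of P backwards). If b ∈ D, rerouting P
-- along a residual path gives an edge set balanced for X, and decomposing it into paths links X,
-- a contradiction. Otherwise every D-crossing edge lies on P and no edge of P enters D, so a path
-- of P leaves D exactly once if it starts in D and never otherwise: D has order |D ∩ F|. Finally
-- D ∩ I ⊆ F, since a further vertex of D ∩ I would give |D ∩ F| + 1 edge-disjoint paths out of D
-- through only |D ∩ F| crossing edges.

open import Defs
open import Axiom.ExcludedMiddle using (ExcludedMiddle)
open import Level using (0ℓ)
import Algebra.Properties.CommutativeMonoid.Sum as CommutativeMonoidSum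
open import Data.Nat using (ℕ; zero; suc; _+_; _≤_; _<_; s≤s; z≤n)
open import Data.Nat.Properties
  using (+-0-commutativeMonoid; +-commutativeSemigroup; +-assoc; +-comm; +-identityʳ; +-cancelˡ-≡;
         suc-injective; ≮⇒≥; 1+n≰n)
open import Data.Nat.ListAction using (sum)
open import Data.Nat.ListAction.Properties using (sum-↭; sum-++)
open import Data.Nat.Tactic.RingSolver using (solve-∀)
open import Algebra.Properties.CommutativeSemigroup +-commutativeSemigroup using (x∙yz≈y∙xz)
open import Data.List using (List; []; _∷_; _++_; map; length; lookup; concat; tabulate; filter)
open import Data.List.Properties using (map-++)
open import Data.List.Membership.Propositional using (_∈_; _∉_)
open import Data.List.Membership.Propositional.Properties
  using (∈-filter⁺; ∈-filter⁻; ∈-++⁺ˡ; ∈-++⁺ʳ; ∈-++⁻; ∈-lookup; ∈-concat⁺′; ∈-tabulate⁺)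
open import Data.List.Membership.Propositional.Properties.WithK using (unique∧set⇒bag)
open import Data.List.Relation.Unary.Any as Any using (here; there)
open import Data.List.Relation.Unary.Any.Properties using (lookup-index)
open import Data.List.Relation.Unary.All as All using (All; []; _∷_)
import Data.List.Relation.Unary.All.Properties as AllP
open AllP using (¬Any⇒All¬)
open import Data.List.Relation.Unary.AllPairs using ([]; _∷_)
import Data.List.Relation.Unary.AllPairs.Properties as AllPairsP
open import Data.List.Relation.Unary.Unique.Propositional using (Unique)
import Data.List.Relation.Unary.Unique.Propositional.Properties as UniqueP
open import Data.List.Relation.Binary.Subset.Propositional using (_⊆_)
open import Data.List.Relation.Binary.Disjoint.Propositional using (Disjoint)
open import Data.List.Relation.Binary.BagAndSetEquality using (∼bag⇒↭)
open import Data.List.Relation.Binary.Permutation.Propositional using (_↭_; ↭-sym)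
open import Data.List.Relation.Binary.Permutation.Propositional.Properties using (map⁺; ↭-length)
open import Data.Fin using (Fin; zero; suc)
open import Data.Fin.Properties using (pigeonhole) renaming (<⇒≢ to <⇒≢ᶠ)
open import Data.Product using (Σ; _×_; _,_; proj₁; proj₂; ∃-syntax)
open import Data.Sum using (_⊎_; inj₁; inj₂; [_,_]′)
open import Data.Empty using (⊥-elim)
open import Function using (id; _∘_; _⇔_; mk⇔)
open import Relation.Nullary using (¬_; yes; no)
open import Relation.Unary using (Decidable)
open import Relation.Binary.PropositionalEquality
  using (_≡_; _≢_; refl; sym; trans; cong; cong₂; subst; module ≡-Reasoning)

module ℕ∑ = CommutativeMonoidSum +-0-commutativeMonoid
open ℕ∑ using (sum-syntax)

unique∧set⇒↭ : {A : Set} {xs ys : List A} → Unique xs → Unique ys →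
  (∀ {x} → x ∈ xs ⇔ x ∈ ys) → xs ↭ ys
unique∧set⇒↭ ux uy same = ∼bag⇒↭ (unique∧set⇒bag ux uy same)

sum-map-↭ : {A : Set} (f : A → ℕ) {xs ys : List A} → xs ↭ ys → sum (map f xs) ≡ sum (map f ys)
sum-map-↭ f p = sum-↭ (map⁺ f p)

sum-map-++ : {A : Set} (f : A → ℕ) (xs ys : List A) →
  sum (map f (xs ++ ys)) ≡ sum (map f xs) + sum (map f ys)
sum-map-++ f xs ys = trans (cong sum (map-++ f xs ys)) (sum-++ (map f xs) (map f ys))

sum-map-concat-tabulate : {A : Set} (g : A → ℕ) {n : ℕ} (f : Fin n → List A) →
  sum (map g (concat (tabulate f))) ≡ ∑[ i < n ] sum (map g (f i))
sum-map-concat-tabulate g {zero} f = refl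
sum-map-concat-tabulate g {suc n} f =
  trans (sum-map-++ g (f zero) _) (cong (sum (map g (f zero)) +_) (sum-map-concat-tabulate g (f ∘ suc)))

∑-lookup : {A : Set} (f : A → ℕ) (xs : List A) → ∑[ i < length xs ] f (lookup xs i) ≡ sum (map f xs)
∑-lookup f [] = refl
∑-lookup f (x ∷ xs) = cong (f x +_) (∑-lookup f xs)

module Classical (em : ExcludedMiddle 0ℓ) where

  decide : {A : Set} (P : A → Set) → Decidable P
  decide P x = em

  by-cases : {P C : Set} → (P → C) → (¬ P → C) → C
  by-cases {P} y n with em {P}
  ... | yes p = y p
  ... | no ¬p = n ¬p

  𝟙 : Set → ℕ
  𝟙 P with em {P}
  ... | yes _ = 1
  ... | no _ = 0

  𝟙-yes : {P : Set} → P → 𝟙 P ≡ 1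
  𝟙-yes {P} p with em {P}
  ... | yes _ = refl
  ... | no ¬p = ⊥-elim (¬p p)

  𝟙-no : {P : Set} → ¬ P → 𝟙 P ≡ 0
  𝟙-no {P} ¬p with em {P}
  ... | yes p = ⊥-elim (¬p p)
  ... | no _ = refl

  count : {A B : Set} → (A → B) → List A → B → ℕ
  count f xs y = sum (map (λ a → 𝟙 (f a ≡ y)) xs)

  length-filter≡sum-𝟙 : {A : Set} (P : A → Set) (xs : List A) →
    length (filter (decide P) xs) ≡ sum (map (𝟙 ∘ P) xs)
  length-filter≡sum-𝟙 P [] = refl
  length-filter≡sum-𝟙 P (x ∷ xs) with em {P x}
  ... | yes _ = cong suc (length-filter≡sum-𝟙 P xs)
  ... | no _ = length-filter≡sum-𝟙 P xs

  count>0⇒∈ : {A B : Set} (f : A → B) (xs : List A) (y : B) →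
    0 < count f xs y → ∃[ a ] (a ∈ xs × f a ≡ y)
  count>0⇒∈ f (a ∷ xs) y pos with em {f a ≡ y}
  ... | yes eq = a , here refl , eq
  ... | no _ with count>0⇒∈ f xs y pos
  ...   | a′ , a′∈ , eq = a′ , there a′∈ , eq

  remove : {A : Set} → A → List A → List A
  remove x = filter (decide (_≢ x))

  ∉-remove : {A : Set} (x : A) (xs : List A) → x ∉ remove x xs
  ∉-remove x xs x∈ = proj₂ (∈-filter⁻ (decide (_≢ x)) {xs = xs} x∈) refl

  ∈-remove⁻ : {A : Set} {x y : A} (xs : List A) → y ∈ remove x xs → y ∈ xs × y ≢ x
  ∈-remove⁻ {x = x} xs = ∈-filter⁻ (decide (_≢ x))

  remove-unique : {A : Set} (x : A) {xs : List A} → Unique xs → Unique (remove x xs)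
  remove-unique x = UniqueP.filter⁺ (decide (_≢ x))

  ↭-remove : {A : Set} {x : A} {xs : List A} → Unique xs → x ∈ xs → xs ↭ x ∷ remove x xs
  ↭-remove {x = x} {xs} uxs x∈ = unique∧set⇒↭ uxs (x∉ ∷ remove-unique x uxs) (mk⇔ to from)
    where
    x∉ : All (x ≢_) (remove x xs)
    x∉ = All.tabulate (λ y∈ x≡y → proj₂ (∈-remove⁻ xs y∈) (sym x≡y))
    to : ∀ {y} → y ∈ xs → y ∈ x ∷ remove x xs
    to {y} y∈ = by-cases (λ y≡x → here y≡x) (λ y≢x → there (∈-filter⁺ (decide (_≢ x)) y∈ y≢x))
    from : ∀ {y} → y ∈ x ∷ remove x xs → y ∈ xs
    from (here refl) = x∈
    from (there y∈) = proj₁ (∈-remove⁻ xs y∈)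

module Walks (em : ExcludedMiddle 0ℓ) (G : Digraph) where
  open Digraph G
  open Classical em

  infixr 5 _++ʷ_
  _++ʷ_ : ∀ {x y z} → Walk G x y → Walk G y z → Walk G x z
  [] ++ʷ q = q
  (e ∷ p) ++ʷ q = e ∷ (p ++ʷ q)

  src∈vertices : ∀ {x y e} (p : Walk G x y) → e ∈ edges G p → src e ∈ vertices G p
  src∈vertices (e ∷ p) (here refl) = here refl
  src∈vertices (e ∷ p) (there e∈) = there (src∈vertices p e∈)

  edges-unique : ∀ {x y} (p : Walk G x y) → Unique (vertices G p) → Unique (edges G p)
  edges-unique [] _ = []
  edges-unique (e ∷ p) (src∉ ∷ u) =
    All.tabulate (λ e′∈ e≡e′ → All.lookup src∉ (src∈vertices p e′∈) (cong src e≡e′))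
      ∷ edges-unique p u

  walk-from : ∀ {x y z} (p : Walk G x y) → z ∈ vertices G p →
    Σ (Walk G z y) λ q → (Unique (vertices G p) → Unique (vertices G q)) × edges G q ⊆ edges G p
  walk-from [] (here refl) = [] , id , id
  walk-from (e ∷ p) (here refl) = e ∷ p , id , id
  walk-from (e ∷ p) (there z∈) with walk-from p z∈
  ... | q , unique , q⊆p = q , (λ { (_ ∷ u) → unique u }) , there ∘ q⊆p

  walk⇒path : ∀ {x y} (p : Walk G x y) → Σ (Path G x y) λ q → edges G (walk q) ⊆ edges G p
  walk⇒path [] = path [] ([] ∷ []) , id
  walk⇒path (e ∷ p) with walk⇒path p
  ... | q , q⊆p with em {src e ∈ vertices G (walk q)}
  ...   | yes src∈ with walk-from (walk q) src∈
  ...     | r , unique , r⊆q = path r (unique (distinct q)) , there ∘ q⊆p ∘ r⊆q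
  walk⇒path (e ∷ p) | q , q⊆p | no src∉ =
    path (e ∷ walk q) (¬Any⇒All¬ _ src∉ ∷ distinct q) ,
      λ { (here refl) → here refl ; (there e′∈) → there (q⊆p e′∈) }

  first-exit : (D : V → Set) → ∀ {x y} (p : Walk G x y) → D x → ¬ D y →
    ∃[ e ] (e ∈ edges G p × Crossing G D e)
  first-exit D [] Dx ¬Dy = ⊥-elim (¬Dy Dx)
  first-exit D (e ∷ p) Dx ¬Dy with em {D (tgt e)}
  ... | no ¬Dt = e , here refl , Dx , ¬Dt
  ... | yes Dt with first-exit D p Dt ¬Dy
  ...   | e′ , e′∈ , crossing = e′ , there e′∈ , crossing

  walk-balance : ∀ {x y} (p : Walk G x y) (u : V) →
    count src (edges G p) u + 𝟙 (y ≡ u) ≡ count tgt (edges G p) u + 𝟙 (x ≡ u)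
  walk-balance [] u = refl
  walk-balance (e ∷ p) u = begin
    (𝟙 (src e ≡ u) + count src (edges G p) u) + _ ≡⟨ +-assoc (𝟙 (src e ≡ u)) _ _ ⟩
    𝟙 (src e ≡ u) + (count src (edges G p) u + _) ≡⟨ cong (𝟙 (src e ≡ u) +_) (walk-balance p u) ⟩
    𝟙 (src e ≡ u) + (count tgt (edges G p) u + 𝟙 (tgt e ≡ u))
      ≡⟨ rearrange (𝟙 (src e ≡ u)) (count tgt (edges G p) u) (𝟙 (tgt e ≡ u)) ⟩
    (𝟙 (tgt e ≡ u) + count tgt (edges G p) u) + 𝟙 (src e ≡ u) ∎
    where
    open ≡-Reasoning
    rearrange : ∀ a b c → a + (b + c) ≡ (c + b) + a
    rearrange = solve-∀

module FlowDecomposition (em : ExcludedMiddle 0ℓ) (G : Digraph) (b : Digraph.V G) where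
  open Digraph G
  open Classical em
  open Walks em G

  record Balanced (S : List E) (T : List V) : Set where
    constructor balanced
    field balance : ∀ u → u ≢ b → count src S u ≡ count tgt S u + count id T u
  open Balanced public

  record Routing (S : List E) (T : List V) : Set where
    field
      route    : (i : Fin (length T)) → Walk G (lookup T i) b
      route⊆S  : ∀ i → edges G (route i) ⊆ S
      disjoint : ∀ {i j} → i ≢ j → Disjoint (edges G (route i)) (edges G (route j))
  open Routing

  routing-[] : ∀ {S} → Routing S []
  routing-[] = record { route = λ () ; route⊆S = λ () ; disjoint = λ { {()} } }

  routing-∷-target : ∀ {S T} → Routing S T → Routing S (b ∷ T)
  routing-∷-target {S} {T} R = record { route = route′ ; route⊆S = route′⊆S ; disjoint = disjoint′ }
    where
    route′ : (i : Fin (suc (length T))) → Walk G (lookup (b ∷ T) i) b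
    route′ zero = []
    route′ (suc i) = route R i
    route′⊆S : ∀ i → edges G (route′ i) ⊆ S
    route′⊆S zero ()
    route′⊆S (suc i) = route⊆S R i
    disjoint′ : ∀ {i j} → i ≢ j → Disjoint (edges G (route′ i)) (edges G (route′ j))
    disjoint′ {zero} _ (() , _)
    disjoint′ {suc i} {zero} _ (_ , ())
    disjoint′ {suc i} {suc j} i≢j = disjoint R (i≢j ∘ cong suc)

  routing-∷-edge : ∀ {S T e} → e ∈ S → Routing (remove e S) (tgt e ∷ T) → Routing S (src e ∷ T)
  routing-∷-edge {S} {T} {e} e∈S R = record { route = route′ ; route⊆S = route′⊆S ; disjoint = disjoint′ }
    where
    route′ : (i : Fin (suc (length T))) → Walk G (lookup (src e ∷ T) i) b
    route′ zero = e ∷ route R zero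
    route′ (suc i) = route R (suc i)
    route′⊆S : ∀ i → edges G (route′ i) ⊆ S
    route′⊆S zero (here refl) = e∈S
    route′⊆S zero (there e′∈) = proj₁ (∈-remove⁻ S (route⊆S R zero e′∈))
    route′⊆S (suc i) e′∈ = proj₁ (∈-remove⁻ S (route⊆S R (suc i) e′∈))
    e∉ : ∀ i → e ∉ edges G (route R i)
    e∉ i e∈ = ∉-remove e S (route⊆S R i e∈)
    disjoint′ : ∀ {i j} → i ≢ j → Disjoint (edges G (route′ i)) (edges G (route′ j))
    disjoint′ {zero} {zero} i≢j = ⊥-elim (i≢j refl)
    disjoint′ {zero} {suc j} _ (here refl , e∈) = e∉ (suc j) e∈
    disjoint′ {zero} {suc j} _ (there e′∈ , e′∈′) = disjoint R (λ ()) (e′∈ , e′∈′)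
    disjoint′ {suc i} {zero} _ (e∈ , here refl) = e∉ (suc i) e∈
    disjoint′ {suc i} {zero} _ (e′∈ , there e′∈′) = disjoint R (λ ()) (e′∈ , e′∈′)
    disjoint′ {suc i} {suc j} = disjoint R

  balanced-∷-target : ∀ {S T} → Balanced S (b ∷ T) → Balanced S T
  balanced-∷-target {S} {T} bal = balanced λ u u≢b →
    trans (balance bal u u≢b) (cong (λ k → count tgt S u + (k + count id T u)) (𝟙-no (u≢b ∘ sym)))

  balanced⇒edge-out : ∀ {S t T} → t ≢ b → Balanced S (t ∷ T) → ∃[ e ] (e ∈ S × src e ≡ t)
  balanced⇒edge-out {S} {t} {T} t≢b bal = count>0⇒∈ src S t (subst (0 <_) (sym (balance bal t t≢b)) out>0)
    where
    out>0 : 0 < count tgt S t + (𝟙 (t ≡ t) + count id T t)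
    out>0 rewrite 𝟙-yes (refl {x = t}) | +-comm (count tgt S t) (suc (count id T t)) = s≤s z≤n

  balanced-∷-edge : ∀ {S T e} → Unique S → e ∈ S →
    Balanced S (src e ∷ T) → Balanced (remove e S) (tgt e ∷ T)
  balanced-∷-edge {S} {T} {e} uS e∈S bal = balanced λ u u≢b → +-cancelˡ-≡ (s u) _ _ (begin
      s u + count src S′ u           ≡⟨ sum-map-↭ (λ a → 𝟙 (src a ≡ u)) (↭-remove uS e∈S) ⟨
      count src S u                   ≡⟨ balance bal u u≢b ⟩
      count tgt S u + (s u + c u)
        ≡⟨ cong (_+ (s u + c u)) (sum-map-↭ (λ a → 𝟙 (tgt a ≡ u)) (↭-remove uS e∈S)) ⟩
      (t u + count tgt S′ u) + (s u + c u) ≡⟨ rearrange (s u) (t u) (count tgt S′ u) (c u) ⟩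
      s u + (count tgt S′ u + (t u + c u)) ∎)
    where
    open ≡-Reasoning
    S′ = remove e S
    s t c : V → ℕ
    s u = 𝟙 (src e ≡ u)
    t u = 𝟙 (tgt e ≡ u)
    c u = count id T u
    rearrange : ∀ s t x c → (t + x) + (s + c) ≡ s + (x + (t + c))
    rearrange = solve-∀

  -- A source equal to b gets the empty walk; any other source has an edge of S leaving it, and
  -- deleting that edge leaves a balanced system in which the edge's head replaces the source.
  decompose : ∀ n {S} (T : List V) → length S ≡ n → Unique S → Balanced S T → Routing S T
  decompose n [] _ _ _ = routing-[]
  decompose n (t ∷ T) len uS bal with em {t ≡ b}
  ... | yes refl = routing-∷-target (decompose n T len uS (balanced-∷-target bal))
  ... | no t≢b with balanced⇒edge-out t≢b bal
  decompose zero {[]} (_ ∷ T) _ _ _ | no _ | _ , () , _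
  decompose (suc n) {S} (_ ∷ T) len uS bal | no _ | e , e∈S , refl =
    routing-∷-edge e∈S (decompose n (tgt e ∷ T) len′ (remove-unique e uS) (balanced-∷-edge uS e∈S bal))
    where
    len′ : length (remove e S) ≡ n
    len′ = suc-injective (trans (sym (↭-length (↭-remove uS e∈S))) len)

  routing⇒linkage : ∀ {S T} → Routing S T → HasLinkage G T b
  routing⇒linkage R = (λ i → proj₁ (walk⇒path (route R i))) ,
    λ i j i≢j e e∈i e∈j →
      disjoint R i≢j (proj₂ (walk⇒path (route R i)) e∈i , proj₂ (walk⇒path (route R j)) e∈j)

  balanced⇒linkage : ∀ {S T} → Unique S → Balanced S T → HasLinkage G T b
  balanced⇒linkage {S} {T} uS bal = routing⇒linkage (decompose (length S) T refl uS bal)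

  balanced-↭ : ∀ {S T T′} → T ↭ T′ → Balanced S T → Balanced S T′
  balanced-↭ {S} T↭T′ bal = balanced λ u u≢b →
    trans (balance bal u u≢b) (cong (count tgt S u +_) (sum-map-↭ (λ a → 𝟙 (a ≡ u)) T↭T′))

module Residual (em : ExcludedMiddle 0ℓ) (G : Digraph) (b : Digraph.V G) (S : List (Digraph.E G)) where
  open Digraph G
  open Classical em
  open Walks em G
  open FlowDecomposition em G b

  ResidualEdge : Set
  ResidualEdge = (Σ E λ e → e ∉ S) ⊎ (Σ E λ e → e ∈ S)

  residual : Digraph
  residual = record
    { V = V
    ; E = ResidualEdge
    ; src = [ src ∘ proj₁ , tgt ∘ proj₁ ]′
    ; tgt = [ tgt ∘ proj₁ , src ∘ proj₁ ]′
    }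
  open Digraph residual using () renaming (src to rsrc; tgt to rtgt)

  forward : ∀ {x y} → Walk residual x y → List E
  forward [] = []
  forward (inj₁ (e , _) ∷ p) = e ∷ forward p
  forward (inj₂ _ ∷ p) = forward p

  backward : ∀ {x y} → Walk residual x y → List E
  backward [] = []
  backward (inj₁ _ ∷ p) = backward p
  backward (inj₂ (e , _) ∷ p) = e ∷ backward p

  forward-∉ : ∀ {x y e} (p : Walk residual x y) → e ∈ forward p → e ∉ S
  forward-∉ (inj₁ (e , e∉) ∷ p) (here refl) = e∉
  forward-∉ (inj₁ _ ∷ p) (there e∈) = forward-∉ p e∈
  forward-∉ (inj₂ _ ∷ p) e∈ = forward-∉ p e∈

  backward⊆S : ∀ {x y} (p : Walk residual x y) → backward p ⊆ S
  backward⊆S (inj₂ (e , e∈S) ∷ p) (here refl) = e∈S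
  backward⊆S (inj₂ _ ∷ p) (there e∈) = backward⊆S p e∈
  backward⊆S (inj₁ _ ∷ p) e∈ = backward⊆S p e∈

  forward-src : ∀ {x y e} (p : Walk residual x y) → e ∈ forward p → src e ∈ vertices residual p
  forward-src (inj₁ _ ∷ p) (here refl) = here refl
  forward-src (inj₁ _ ∷ p) (there e∈) = there (forward-src p e∈)
  forward-src (inj₂ _ ∷ p) e∈ = there (forward-src p e∈)

  backward-tgt : ∀ {x y e} (p : Walk residual x y) → e ∈ backward p → tgt e ∈ vertices residual p
  backward-tgt (inj₂ _ ∷ p) (here refl) = here refl
  backward-tgt (inj₂ _ ∷ p) (there e∈) = there (backward-tgt p e∈)
  backward-tgt (inj₁ _ ∷ p) e∈ = there (backward-tgt p e∈)

  forward-unique : ∀ {x y} (p : Walk residual x y) → Unique (vertices residual p) → Unique (forward p)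
  forward-unique [] _ = []
  forward-unique (inj₁ _ ∷ p) (src∉ ∷ u) =
    All.tabulate (λ e′∈ e≡e′ → All.lookup src∉ (forward-src p e′∈) (cong src e≡e′))
      ∷ forward-unique p u
  forward-unique (inj₂ _ ∷ p) (_ ∷ u) = forward-unique p u

  backward-unique : ∀ {x y} (p : Walk residual x y) → Unique (vertices residual p) → Unique (backward p)
  backward-unique [] _ = []
  backward-unique (inj₂ _ ∷ p) (tgt∉ ∷ u) =
    All.tabulate (λ e′∈ e≡e′ → All.lookup tgt∉ (backward-tgt p e′∈) (cong tgt e≡e′))
      ∷ backward-unique p u
  backward-unique (inj₁ _ ∷ p) (_ ∷ u) = backward-unique p u

  count-rsrc : ∀ {x y} (p : Walk residual x y) (u : V) →
    count rsrc (edges residual p) u ≡ count src (forward p) u + count tgt (backward p) u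
  count-rsrc [] u = refl
  count-rsrc (inj₁ (e , _) ∷ p) u = trans (cong (_ +_) (count-rsrc p u)) (sym (+-assoc (𝟙 (src e ≡ u)) _ _))
  count-rsrc (inj₂ (e , _) ∷ p) u =
    trans (cong (_ +_) (count-rsrc p u)) (x∙yz≈y∙xz (𝟙 (tgt e ≡ u)) (count src (forward p) u) _)

  count-rtgt : ∀ {x y} (p : Walk residual x y) (u : V) →
    count rtgt (edges residual p) u ≡ count tgt (forward p) u + count src (backward p) u
  count-rtgt [] u = refl
  count-rtgt (inj₁ (e , _) ∷ p) u = trans (cong (_ +_) (count-rtgt p u)) (sym (+-assoc (𝟙 (tgt e ≡ u)) _ _))
  count-rtgt (inj₂ (e , _) ∷ p) u =
    trans (cong (_ +_) (count-rtgt p u)) (x∙yz≈y∙xz (𝟙 (src e ≡ u)) (count tgt (forward p) u) _)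

  residual-balance : ∀ {x y} (p : Walk residual x y) (u : V) →
    count src (forward p) u + count tgt (backward p) u + 𝟙 (y ≡ u)
      ≡ count tgt (forward p) u + count src (backward p) u + 𝟙 (x ≡ u)
  residual-balance p u = begin
    count src (forward p) u + count tgt (backward p) u + _ ≡⟨ cong (_+ _) (count-rsrc p u) ⟨
    count rsrc (edges residual p) u + _                    ≡⟨ Walks.walk-balance em residual p u ⟩
    count rtgt (edges residual p) u + _                    ≡⟨ cong (_+ _) (count-rtgt p u) ⟩
    count tgt (forward p) u + count src (backward p) u + _ ∎
    where open ≡-Reasoning

  -- Along a residual path from v to b every other vertex keeps its balance, while v gains one net
  -- outgoing edge.
  augment : ∀ {T v} → Unique S → Balanced S T → Path residual v b →
    Σ (List E) λ S′ → Unique S′ × Balanced S′ (v ∷ T)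
  augment {T} {v} uS bal q = A ++ F , uA++F , balanced balance′
    where
    R = walk q
    F = forward R
    B = backward R
    A = filter (decide (_∉ B)) S
    uA : Unique A
    uA = UniqueP.filter⁺ (decide (_∉ B)) uS
    uA++F : Unique (A ++ F)
    uA++F = UniqueP.++⁺ uA (forward-unique R (distinct q))
      λ (e∈A , e∈F) → forward-∉ R e∈F (proj₁ (∈-filter⁻ (decide (_∉ B)) {xs = S} e∈A))
    S↭A++B : S ↭ A ++ B
    S↭A++B = unique∧set⇒↭ uS (UniqueP.++⁺ uA (backward-unique R (distinct q)) A#B) (mk⇔ to from)
      where
      A#B : ∀ {e} → ¬ (e ∈ A × e ∈ B)
      A#B (e∈A , e∈B) = proj₂ (∈-filter⁻ (decide (_∉ B)) {xs = S} e∈A) e∈B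
      to : ∀ {e} → e ∈ S → e ∈ A ++ B
      to e∈S = by-cases (∈-++⁺ʳ A) (∈-++⁺ˡ ∘ ∈-filter⁺ (decide (_∉ B)) e∈S)
      from : ∀ {e} → e ∈ A ++ B → e ∈ S
      from e∈ = [ proj₁ ∘ ∈-filter⁻ (decide (_∉ B)) {xs = S} , backward⊆S R ]′ (∈-++⁻ A e∈)
    split : ∀ (g : E → ℕ) → sum (map g S) ≡ sum (map g A) + sum (map g B)
    split g = trans (sum-map-↭ g S↭A++B) (sum-map-++ g A B)
    arith : ∀ oA oB iA iB c oF iF z → oA + oB ≡ (iA + iB) + c → oF + iB + 0 ≡ iF + oB + z →
      oA + oF ≡ (iA + iF) + (z + c)
    arith oA oB iA iB c oF iF z hS hR = +-cancelˡ-≡ (oB + iB) _ _ (begin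
      (oB + iB) + (oA + oF)             ≡⟨ regroupˡ oA oB iB oF ⟩
      (oA + oB) + (oF + iB + 0)         ≡⟨ cong₂ _+_ hS hR ⟩
      ((iA + iB) + c) + (iF + oB + z)   ≡⟨ regroupʳ oB iA iB c iF z ⟩
      (oB + iB) + ((iA + iF) + (z + c)) ∎)
      where
      open ≡-Reasoning
      regroupˡ : ∀ oA oB iB oF → (oB + iB) + (oA + oF) ≡ (oA + oB) + (oF + iB + 0)
      regroupˡ = solve-∀
      regroupʳ : ∀ oB iA iB c iF z → ((iA + iB) + c) + (iF + oB + z) ≡ (oB + iB) + ((iA + iF) + (z + c))
      regroupʳ = solve-∀
    balance′ : ∀ u → u ≢ b → count src (A ++ F) u ≡ count tgt (A ++ F) u + count id (v ∷ T) u
    balance′ u u≢b = begin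
      count src (A ++ F) u                    ≡⟨ sum-map-++ _ A F ⟩
      count src A u + count src F u           ≡⟨ arith (count src A u) (count src B u) (count tgt A u) (count tgt B u)
                                                   (count id T u) (count src F u) (count tgt F u) (𝟙 (v ≡ u)) hS hR ⟩
      (count tgt A u + count tgt F u) + _     ≡⟨ cong (_+ _) (sum-map-++ _ A F) ⟨
      count tgt (A ++ F) u + count id (v ∷ T) u ∎
      where
      open ≡-Reasoning
      hS : count src A u + count src B u ≡ (count tgt A u + count tgt B u) + count id T u
      hS = trans (sym (split _)) (trans (balance bal u u≢b) (cong (_+ count id T u) (split _)))
      hR : count src F u + count tgt B u + 0 ≡ count tgt F u + count src B u + 𝟙 (v ≡ u)
      hR = trans (cong (count src F u + count tgt B u +_) (sym (𝟙-no (u≢b ∘ sym)))) (residual-balance R u)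

module Cuts (em : ExcludedMiddle 0ℓ) (G : Digraph) (b : Digraph.V G) where
  open Digraph G
  open Classical em
  open Walks em G

  crossings : (V → Set) → List E → ℕ
  crossings D es = sum (map (𝟙 ∘ Crossing G D) es)

  𝟙-crossing : (D : V → Set) (e : E) → (D (tgt e) → D (src e)) →
    𝟙 (Crossing G D e) + 𝟙 (D (tgt e)) ≡ 𝟙 (D (src e))
  𝟙-crossing D e closed with em {D (src e)} | em {D (tgt e)}
  ... | yes _  | yes Dt  rewrite 𝟙-no {Crossing G D e} (λ (_ , ¬Dt) → ¬Dt Dt) = refl
  ... | yes Ds | no ¬Dt  rewrite 𝟙-yes {Crossing G D e} (Ds , ¬Dt) = refl
  ... | no ¬Ds | yes Dt  = ⊥-elim (¬Ds (closed Dt))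
  ... | no ¬Ds | no _    rewrite 𝟙-no {Crossing G D e} (¬Ds ∘ proj₁) = refl

  crossings-along : (D : V → Set) {S : List E} → (∀ {e} → e ∈ S → D (tgt e) → D (src e)) →
    ∀ {x y} (p : Walk G x y) → edges G p ⊆ S → ¬ D y → crossings D (edges G p) ≡ 𝟙 (D x)
  crossings-along D closed [] _ ¬Dy = sym (𝟙-no ¬Dy)
  crossings-along D closed (e ∷ p) p⊆S ¬Dy = begin
    𝟙 (Crossing G D e) + crossings D (edges G p) ≡⟨ cong (_ +_) (crossings-along D closed p (p⊆S ∘ there) ¬Dy) ⟩
    𝟙 (Crossing G D e) + 𝟙 (D (tgt e))         ≡⟨ 𝟙-crossing D e (closed (p⊆S (here refl))) ⟩
    𝟙 (D (src e))                              ∎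
    where open ≡-Reasoning

  -- Each path of the linkage contains a D-crossing edge; by edge-disjointness these are distinct.
  linkage-length≤order : (D : V → Set) → ¬ D b → (L : List E) → (∀ {e} → Crossing G D e → e ∈ L) →
    (K : List V) → All D K → HasLinkage G K b → length K ≤ length L
  linkage-length≤order D ¬Db L crossing∈L K DK (P , disjoint) = ≮⇒≥ collision
    where
    exit : (i : Fin (length K)) → ∃[ e ] (e ∈ edges G (walk (P i)) × Crossing G D e)
    exit i = first-exit D (walk (P i)) (All.lookup DK (∈-lookup i)) ¬Db
    exit∈ : ∀ i → proj₁ (exit i) ∈ edges G (walk (P i))
    exit∈ i = proj₁ (proj₂ (exit i))
    slot : Fin (length K) → Fin (length L)
    slot i = Any.index (crossing∈L (proj₂ (proj₂ (exit i))))
    slot-edge : ∀ i → proj₁ (exit i) ≡ lookup L (slot i)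
    slot-edge i = lookup-index (crossing∈L (proj₂ (proj₂ (exit i))))
    collision : ¬ length L < length K
    collision L<K with pigeonhole L<K slot
    ... | i , j , i<j , same-slot =
      disjoint i j (<⇒≢ᶠ i<j) _ (exit∈ i) (subst (_∈ edges G (walk (P j))) same-exit (exit∈ j))
      where
      same-exit : proj₁ (exit j) ≡ proj₁ (exit i)
      same-exit = trans (slot-edge j) (trans (cong (lookup L) (sym same-slot)) (sym (slot-edge i)))

module LinkageResidual (em : ExcludedMiddle 0ℓ) (G : Digraph) (b : Digraph.V G)
  (F : List (Digraph.V G)) (linkage : HasLinkage G F b) where
  open Digraph G
  open Classical em
  open Walks em G
  open FlowDecomposition em G b
  open Cuts em G b

  n : ℕ
  n = length F

  path-edges : Fin n → List E
  path-edges i = edges G (walk (proj₁ linkage i))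

  S : List E
  S = concat (tabulate path-edges)

  path-edges⊆S : ∀ i → path-edges i ⊆ S
  path-edges⊆S i e∈ = ∈-concat⁺′ e∈ (∈-tabulate⁺ i)

  S-unique : Unique S
  S-unique = UniqueP.concat⁺
    (AllP.tabulate⁺ λ i → edges-unique _ (distinct (proj₁ linkage i)))
    (AllPairsP.tabulate⁺ λ i≢j (e∈i , e∈j) → proj₂ linkage _ _ i≢j _ e∈i e∈j)

  path-balance : ∀ u → u ≢ b → ∀ i →
    count src (path-edges i) u ≡ count tgt (path-edges i) u + 𝟙 (lookup F i ≡ u)
  path-balance u u≢b i = begin
    count src (path-edges i) u                      ≡⟨ +-identityʳ _ ⟨
    count src (path-edges i) u + 0                  ≡⟨ cong (count src (path-edges i) u +_) (𝟙-no (u≢b ∘ sym)) ⟨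
    count src (path-edges i) u + 𝟙 (b ≡ u)          ≡⟨ walk-balance (walk (proj₁ linkage i)) u ⟩
    count tgt (path-edges i) u + 𝟙 (lookup F i ≡ u) ∎
    where open ≡-Reasoning

  S-balanced : Balanced S F
  S-balanced = balanced λ u u≢b → begin
    count src S u                                           ≡⟨ sum-map-concat-tabulate _ path-edges ⟩
    ∑[ i < n ] count src (path-edges i) u                   ≡⟨ ℕ∑.sum-cong-≗ (path-balance u u≢b) ⟩
    ∑[ i < n ] (count tgt (path-edges i) u + 𝟙 (lookup F i ≡ u))
      ≡⟨ ℕ∑.∑-distrib-+ (λ i → count tgt (path-edges i) u) (λ i → 𝟙 (lookup F i ≡ u)) ⟩
    ∑[ i < n ] count tgt (path-edges i) u + ∑[ i < n ] 𝟙 (lookup F i ≡ u)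
      ≡⟨ cong₂ _+_ (sum-map-concat-tabulate _ path-edges) (sym (∑-lookup (λ x → 𝟙 (x ≡ u)) F)) ⟨
    count tgt S u + count id F u                            ∎
    where open ≡-Reasoning

  open Residual em G b S
  open Walks em residual using () renaming (_++ʷ_ to _++ʳ_; walk⇒path to walk⇒pathʳ)

  reached-target⇒linkage : ∀ {v xs} → xs ↭ v ∷ F → Walk residual v b → HasLinkage G xs b
  reached-target⇒linkage xs↭ r with augment S-unique S-balanced (proj₁ (walk⇒pathʳ r))
  ... | S′ , uS′ , bal′ = balanced⇒linkage uS′ (balanced-↭ (↭-sym xs↭) bal′)

  module _ (v : V) where

    Reached : V → Set
    Reached = Walk residual v

    crossing⇒∈S : ∀ {e} → Crossing G Reached e → e ∈ S
    crossing⇒∈S {e} (reached , ¬reached) =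
      by-cases id λ e∉S → ⊥-elim (¬reached (reached ++ʳ (inj₁ (e , e∉S) ∷ [])))

    S-not-entering : ∀ {e} → e ∈ S → Reached (tgt e) → Reached (src e)
    S-not-entering {e} e∈S reached = reached ++ʳ (inj₂ (e , e∈S) ∷ [])

    crossing-edges : List E
    crossing-edges = filter (decide (Crossing G Reached)) S

    crossing⇒∈crossing-edges : ∀ {e} → Crossing G Reached e → e ∈ crossing-edges
    crossing⇒∈crossing-edges cr = ∈-filter⁺ _ (crossing⇒∈S cr) cr

    reached-sources : List V
    reached-sources = filter (decide Reached) F

    length-crossing-edges : ¬ Reached b → length crossing-edges ≡ length reached-sources
    length-crossing-edges ¬Rb = begin
        length crossing-edges                  ≡⟨ length-filter≡sum-𝟙 (Crossing G Reached) S ⟩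
        crossings Reached S                    ≡⟨ sum-map-concat-tabulate (𝟙 ∘ Crossing G Reached) path-edges ⟩
        ∑[ i < n ] crossings Reached (path-edges i)
          ≡⟨ ℕ∑.sum-cong-≗ (λ i →
               crossings-along Reached S-not-entering (walk (proj₁ linkage i)) (path-edges⊆S i) ¬Rb) ⟩
        ∑[ i < n ] 𝟙 (Reached (lookup F i))    ≡⟨ ∑-lookup (𝟙 ∘ Reached) F ⟩
        sum (map (𝟙 ∘ Reached) F)              ≡⟨ length-filter≡sum-𝟙 Reached F ⟨
        length reached-sources                 ∎
      where open ≡-Reasoning

    order-of-reached : ¬ Reached b → HasOrder G Reached (length reached-sources)
    order-of-reached ¬Rb =
      crossing-edges , UniqueP.filter⁺ _ S-unique , (λ e e∈ → proj₂ (∈-filter⁻ _ {xs = S} e∈)) ,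
      (λ e → crossing⇒∈crossing-edges) , length-crossing-edges ¬Rb

    reached-sources-unique : Unique F → Unique reached-sources
    reached-sources-unique = UniqueP.filter⁺ _

    -- Adding x to the reached sources would need more edge-disjoint paths out of the reached set
    -- than it has crossing edges.
    reached∩linkable⊆sources : ∀ {I} → FinitelyLinkable G I b → Unique F → All I F → ¬ Reached b →
      ∀ {x} → Reached x → I x → x ∈ reached-sources
    reached∩linkable⊆sources I-linkable uF IF ¬Rb {x} Rx Ix = by-cases id λ x∉K →
      ⊥-elim (1+n≰n (subst (length (x ∷ K) ≤_) (length-crossing-edges ¬Rb)
        (linkage-length≤order Reached ¬Rb crossing-edges crossing⇒∈crossing-edges (x ∷ K)
          (Rx ∷ All.tabulate (proj₂ ∘ ∈-filter⁻ _ {xs = F}))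
          (I-linkable (x ∷ K) (¬Any⇒All¬ K x∉K ∷ reached-sources-unique uF)
            (Ix ∷ All.tabulate (All.lookup IF ∘ proj₁ ∘ ∈-filter⁻ _ {xs = F}))))))
      where
      K = reached-sources

module _ (em : ExcludedMiddle 0ℓ) (G : Digraph) (b : Digraph.V G) where
  open Digraph G
  open Classical em

  maximal⇒unlinkable-extension : ∀ {I v} → MaximalLinkable G I b → v ≢ b → ¬ I v →
    Σ (List V) λ xs → Unique xs × All (λ x → I x ⊎ x ≡ v) xs × ¬ HasLinkage G xs b
  maximal⇒unlinkable-extension {I} {v} (I≢b , I-linkable , maximal) v≢b ¬Iv =
    by-cases id λ none → ⊥-elim (¬Iv (maximal J (λ _ → inj₁) J≢b (J-linkable none) v (inj₂ refl)))
    where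
    J : V → Set
    J x = I x ⊎ x ≡ v
    J≢b : ∀ x → J x → x ≢ b
    J≢b x (inj₁ Ix) = I≢b x Ix
    J≢b x (inj₂ refl) = v≢b
    J-linkable : ¬ (Σ (List V) λ xs → Unique xs × All J xs × ¬ HasLinkage G xs b) → FinitelyLinkable G J b
    J-linkable none xs uxs Jxs = by-cases id λ ¬linked → ⊥-elim (none (xs , uxs , Jxs , ¬linked))

  unlinkable-extension⇒exact : ∀ {I v} → FinitelyLinkable G I b →
    (xs : List V) → Unique xs → All (λ x → I x ⊎ x ≡ v) xs → ¬ HasLinkage G xs b →
    Σ (V → Set) λ D → Exact G I b D × D v
  unlinkable-extension⇒exact {I} {v} I-linkable xs uxs Jxs ¬linked =
    Reached v ,
    (¬Rb , length K , order-of-reached v ¬Rb , K , reached-sources-unique v uF , ⊆D∩I , D∩I⊆ , refl) , []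
    where
    v∈xs : v ∈ xs
    v∈xs = by-cases id λ v∉xs → ⊥-elim (¬linked (I-linkable xs uxs
      (All.tabulate λ x∈ → [ id , (λ { refl → ⊥-elim (v∉xs x∈) }) ]′ (All.lookup Jxs x∈))))
    F = remove v xs
    uF : Unique F
    uF = remove-unique v uxs
    IF : All I F
    IF = All.tabulate λ x∈ → let (x∈xs , x≢v) = ∈-remove⁻ xs x∈ in
      [ id , (λ x≡v → ⊥-elim (x≢v x≡v)) ]′ (All.lookup Jxs x∈xs)
    linkage = I-linkable F uF IF
    open LinkageResidual em G b F linkage
    ¬Rb : ¬ Reached v b
    ¬Rb = ¬linked ∘ reached-target⇒linkage (↭-remove uxs v∈xs)
    K = reached-sources v
    ⊆D∩I : ∀ x → x ∈ K → Reached v x × I x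
    ⊆D∩I x x∈K = let (x∈F , Rx) = ∈-filter⁻ _ {xs = F} x∈K in Rx , All.lookup IF x∈F
    D∩I⊆ : ∀ x → Reached v x × I x → x ∈ K
    D∩I⊆ x (Rx , Ix) = reached∩linkable⊆sources v I-linkable uF IF ¬Rb Rx Ix

lemma3p3 : ExcludedMiddle 0ℓ → (G : Digraph) → (b : Digraph.V G) → (I : Digraph.V G → Set)
    → MaximalLinkable G I b → (v : Digraph.V G) → v ≢ b → ¬ I v
    → Σ (Digraph.V G → Set) λ D → Exact G I b D × D v
lemma3p3 em G b I maximal v v≢b ¬Iv =
  let (xs , uxs , Jxs , ¬linked) = maximal⇒unlinkable-extension em G b maximal v≢b ¬Iv
  in unlinkable-extension⇒exact em G b (proj₁ (proj₂ maximal)) xs uxs Jxs ¬linked
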